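{- Let $X$ and $X'$ be finite alphabets, each with a decomposition into GEN, PROP, KILL symbols, of sizes $(g,t,k)$ and $(g',t',k')$. If $|X|=|X'|=N$ and $gt=g't'$, then for every $L\ge0$ the number of cascade-free sequences in $X^L$ equals the number of cascade-free sequences in $X'^L$, regardless of how $g,t,k$ and $g',t',k'$ are individually distributed.
   Context: GEN symbols act on the state space $\{0,1\}$ as the constant map $1$, PROP symbols as the identity, KILL symbols as the constant map $0$. For $x_1,\dots,x_L$ set $\sigma_0=0$, $\sigma_j=T_{x_j}(\sigma_{j-1})$; the sequence is cascade-free if no $j$ has $x_j\in$ PROP and $\sigma_{j-1}=1$. -}

module Defs where

open import Data.Nat using (ℕ; zero; suc; _*_)
open import Data.Bool using (Bool; true; false; _∧_; not)
open import Data.Fin using (Fin)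
open import Data.Vec using (Vec; []; _∷_)
open import Data.List using (List; []; _∷_; map; concatMap; filterᵇ; length; [_])
open import Data.List.Base using (allFin)

data Kind : Set where
  GEN PROP KILL : Kind

-- A finite alphabet of size N with a decomposition into GEN/PROP/KILL
-- is given by a classification  cls : Fin N → Kind.

-- The transition T_x on the state space {0,1} (encoded as Bool, 1 = true)
T : Kind → Bool → Bool
T GEN  _ = true
T PROP σ = σ
T KILL _ = false

isGEN isPROP : Kind → Bool
isGEN GEN = true
isGEN _   = false
isPROP PROP = true
isPROP _    = false

countKind : ∀ {N} → (Kind → Bool) → (Fin N → Kind) → ℕ
countKind p cls = length (filterᵇ (λ i → p (cls i)) (allFin _))

cfFrom : ∀ {N L} → (Fin N → Kind) → Bool → Vec (Fin N) L → Bool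
cfFrom cls σ []       = true
cfFrom cls σ (x ∷ xs) = not (isPROP (cls x) ∧ σ) ∧ cfFrom cls (T (cls x) σ) xs

cascadeFree : ∀ {N L} → (Fin N → Kind) → Vec (Fin N) L → Bool
cascadeFree cls xs = cfFrom cls false xs

allWords : (N L : ℕ) → List (Vec (Fin N) L)
allWords N zero    = [ [] ]
allWords N (suc L) = concatMap (λ x → map (x ∷_) (allWords N L)) (allFin N)

numCascadeFree : ∀ {N} → (Fin N → Kind) → ℕ → ℕ
numCascadeFree {N} cls L = length (filterᵇ (cascadeFree cls) (allWords N L))

{-# OPTIONS --safe #-}
module Submission where

-- Let a L and b L count the words of length L that are cascade-free when read from state 0
-- and from state 1. Splitting off the first symbol gives a (L+1) = g b L + (t + k) a L and
-- b (L+1) = g b L + k a L, since PROP is forbidden in state 1. Eliminating b yields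
-- a (L+2) = N a (L+1) - g t a L with a 0 = 1 and a 1 = N: a recurrence that sees only N and g t.

open import Defs
open import Data.Nat using (ℕ; zero; suc; _*_; _+_)
open import Data.Nat.Properties using (+-cancelʳ-≡; +-identityʳ; *-identityʳ; *-zeroʳ)
open import Data.Nat.ListAction using (sum)
open import Data.Nat.Tactic.RingSolver using (solve-∀)
open import Data.Bool using (Bool; true; false; _∧_; not; if_then_else_)
open import Data.Fin using (Fin)
import Data.Vec as Vec
open import Data.List using (List; []; _∷_; _++_; map; concatMap; filterᵇ; length; allFin)
open import Data.List.Properties using (length-++; filter-++; filter-none; length-tabulate; map-cong)
open import Data.List.Relation.Unary.All using (universal)
open import Data.Product using (_×_; _,_; proj₁)
open import Function using (_∘_)
open import Relation.Nullary.Decidable using (T?)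
open import Relation.Binary.PropositionalEquality using (_≡_; refl; sym; trans; cong; cong₂; module ≡-Reasoning)

length-filterᵇ-++ : ∀ {A : Set} (p : A → Bool) (xs ys : List A) →
  length (filterᵇ p (xs ++ ys)) ≡ length (filterᵇ p xs) + length (filterᵇ p ys)
length-filterᵇ-++ p xs ys = trans (cong length (filter-++ (T? ∘ p) xs ys)) (length-++ (filterᵇ p xs))

length-filterᵇ-concatMap : ∀ {A B : Set} (p : B → Bool) (f : A → List B) (xs : List A) →
  length (filterᵇ p (concatMap f xs)) ≡ sum (map (length ∘ filterᵇ p ∘ f) xs)
length-filterᵇ-concatMap p f []       = refl
length-filterᵇ-concatMap p f (x ∷ xs) =
  trans (length-filterᵇ-++ p (f x) (concatMap f xs))
        (cong (length (filterᵇ p (f x)) +_) (length-filterᵇ-concatMap p f xs))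

length-filterᵇ-map : ∀ {A B : Set} (p : B → Bool) (f : A → B) (xs : List A) →
  length (filterᵇ p (map f xs)) ≡ length (filterᵇ (p ∘ f) xs)
length-filterᵇ-map p f []       = refl
length-filterᵇ-map p f (x ∷ xs) with p (f x)
... | true  = cong suc (length-filterᵇ-map p f xs)
... | false = length-filterᵇ-map p f xs

length-filterᵇ-guard : ∀ {A : Set} (b : Bool) (q : A → Bool) (xs : List A) →
  length (filterᵇ (λ x → b ∧ q x) xs) ≡ (if b then length (filterᵇ q xs) else 0)
length-filterᵇ-guard true  q xs = refl
length-filterᵇ-guard false q xs = cong length (filter-none (T? ∘ λ _ → false) (universal (λ _ ()) xs))

sum-map-const-1 : ∀ {A : Set} (xs : List A) → sum (map (λ _ → 1) xs) ≡ length xs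
sum-map-const-1 []       = refl
sum-map-const-1 (x ∷ xs) = cong suc (sum-map-const-1 xs)

a*1+b*1+c*1≡a+b+c : ∀ a b c → a * 1 + b * 1 + c * 1 ≡ a + b + c
a*1+b*1+c*1≡a+b+c a b c = cong₂ _+_ (cong₂ _+_ (*-identityʳ a) (*-identityʳ b)) (*-identityʳ c)

isKILL : Kind → Bool
isKILL KILL = true
isKILL _    = false

module _ {A : Set} (kind : A → Kind) where

  countBy : (Kind → Bool) → List A → ℕ
  countBy p = length ∘ filterᵇ (p ∘ kind)

  sum-map-by-kind : ∀ (h : Kind → ℕ) xs → sum (map (h ∘ kind) xs) ≡
    countBy isGEN xs * h GEN + countBy isPROP xs * h PROP + countBy isKILL xs * h KILL
  sum-map-by-kind h []       = refl
  sum-map-by-kind h (x ∷ xs) with kind x | sum-map-by-kind h xs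
  ... | GEN  | ih = trans (cong (h GEN +_) ih)
    (GEN-step (countBy isGEN xs) (countBy isPROP xs) (countBy isKILL xs) (h GEN) (h PROP) (h KILL))
    where GEN-step : ∀ g p k a b c → a + (g * a + p * b + k * c) ≡ suc g * a + p * b + k * c
          GEN-step = solve-∀
  ... | PROP | ih = trans (cong (h PROP +_) ih)
    (PROP-step (countBy isGEN xs) (countBy isPROP xs) (countBy isKILL xs) (h GEN) (h PROP) (h KILL))
    where PROP-step : ∀ g p k a b c → b + (g * a + p * b + k * c) ≡ g * a + suc p * b + k * c
          PROP-step = solve-∀
  ... | KILL | ih = trans (cong (h KILL +_) ih)
    (KILL-step (countBy isGEN xs) (countBy isPROP xs) (countBy isKILL xs) (h GEN) (h PROP) (h KILL))
    where KILL-step : ∀ g p k a b c → c + (g * a + p * b + k * c) ≡ g * a + p * b + suc k * c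
          KILL-step = solve-∀

recurrence-unique : ∀ (n c : ℕ) {x y : ℕ → ℕ} → x 0 ≡ y 0 → x 1 ≡ y 1 →
  (∀ L → x (suc (suc L)) + c * x L ≡ n * x (suc L)) →
  (∀ L → y (suc (suc L)) + c * y L ≡ n * y (suc L)) →
  ∀ L → x L ≡ y L
recurrence-unique n c {x} {y} x₀ x₁ recx recy L = proj₁ (agree L)
  where
  agree : ∀ L → x L ≡ y L × x (suc L) ≡ y (suc L)
  agree zero    = x₀ , x₁
  agree (suc L) with agree L
  ... | xL , xL+1 = xL+1 , +-cancelʳ-≡ (c * x L) _ _ (begin
      x (suc (suc L)) + c * x L  ≡⟨ recx L ⟩
      n * x (suc L)              ≡⟨ cong (n *_) xL+1 ⟩
      n * y (suc L)              ≡⟨ recy L ⟨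
      y (suc (suc L)) + c * y L  ≡⟨ cong (λ z → y (suc (suc L)) + c * z) xL ⟨
      y (suc (suc L)) + c * x L  ∎)
    where open ≡-Reasoning

-- The GEN terms telescope: g * b (suc L) + g * p * a L = g * a (suc L).
transfer-recurrence : ∀ (g p k : ℕ) {a b : ℕ → ℕ} →
  (∀ L → a (suc L) ≡ g * b L + p * a L + k * a L) →
  (∀ L → b (suc L) ≡ g * b L + k * a L) →
  ∀ L → a (suc (suc L)) + g * p * a L ≡ (g + p + k) * a (suc L)
transfer-recurrence g p k {a} {b} a-suc b-suc L
  rewrite a-suc (suc L) | b-suc L | a-suc L = eliminate-b g p k (a L) (b L)
  where
  eliminate-b : ∀ g p k a b →
    g * (g * b + k * a) + p * (g * b + p * a + k * a) + k * (g * b + p * a + k * a) + g * p * a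
      ≡ (g + p + k) * (g * b + p * a + k * a)
  eliminate-b = solve-∀

module CascadeFree {N : ℕ} (cls : Fin N → Kind) where

  gens props kills : ℕ
  gens  = countKind isGEN cls
  props = countKind isPROP cls
  kills = countKind isKILL cls

  N≡gens+props+kills : N ≡ gens + props + kills
  N≡gens+props+kills = begin
    N                                         ≡⟨ length-tabulate (λ i → i) ⟨
    length (allFin N)                         ≡⟨ sum-map-const-1 (allFin N) ⟨
    sum (map (λ _ → 1) (allFin N))            ≡⟨ sum-map-by-kind cls (λ _ → 1) (allFin N) ⟩
    gens * 1 + props * 1 + kills * 1          ≡⟨ a*1+b*1+c*1≡a+b+c gens props kills ⟩
    gens + props + kills                      ∎
    where open ≡-Reasoning

  cfCount : Bool → ℕ → ℕ
  cfCount σ L = length (filterᵇ (cfFrom cls σ) (allWords N L))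

  cfCountAfter : Bool → Kind → ℕ → ℕ
  cfCountAfter σ k L = if not (isPROP k ∧ σ) then cfCount (T k σ) L else 0

  cfCount-suc : ∀ σ L → cfCount σ (suc L) ≡
    gens * cfCountAfter σ GEN L + props * cfCountAfter σ PROP L + kills * cfCountAfter σ KILL L
  cfCount-suc σ L = begin
    cfCount σ (suc L)
      ≡⟨ length-filterᵇ-concatMap (cfFrom cls σ) (λ x → map (x Vec.∷_) (allWords N L)) (allFin N) ⟩
    sum (map (λ x → length (filterᵇ (cfFrom cls σ) (map (x Vec.∷_) (allWords N L)))) (allFin N))
      ≡⟨ cong sum (map-cong firstSymbol (allFin N)) ⟩
    sum (map (λ x → cfCountAfter σ (cls x) L) (allFin N))
      ≡⟨ sum-map-by-kind cls (λ k → cfCountAfter σ k L) (allFin N) ⟩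
    gens * cfCountAfter σ GEN L + props * cfCountAfter σ PROP L + kills * cfCountAfter σ KILL L ∎
    where
    open ≡-Reasoning
    firstSymbol : ∀ x →
      length (filterᵇ (cfFrom cls σ) (map (x Vec.∷_) (allWords N L))) ≡ cfCountAfter σ (cls x) L
    firstSymbol x = trans (length-filterᵇ-map (cfFrom cls σ) (x Vec.∷_) (allWords N L))
                          (length-filterᵇ-guard (not (isPROP (cls x) ∧ σ)) (cfFrom cls (T (cls x) σ)) (allWords N L))

  numCascadeFree-one : numCascadeFree cls 1 ≡ N
  numCascadeFree-one =
    trans (cfCount-suc false 0)
          (trans (a*1+b*1+c*1≡a+b+c gens props kills) (sym N≡gens+props+kills))

  cfCount-true-suc : ∀ L → cfCount true (suc L) ≡ gens * cfCount true L + kills * cfCount false L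
  cfCount-true-suc L = trans (cfCount-suc true L)
    (cong (_+ kills * cfCount false L) (trans (cong (gens * cfCount true L +_) (*-zeroʳ props)) (+-identityʳ _)))

  numCascadeFree-recurrence : ∀ L →
    numCascadeFree cls (suc (suc L)) + gens * props * numCascadeFree cls L ≡ N * numCascadeFree cls (suc L)
  numCascadeFree-recurrence L =
    trans (transfer-recurrence gens props kills (cfCount-suc false) cfCount-true-suc L)
          (cong (_* cfCount false (suc L)) (sym N≡gens+props+kills))

corollary3p6 : (N : ℕ) (cls cls′ : Fin N → Kind) →
    countKind isGEN cls * countKind isPROP cls ≡ countKind isGEN cls′ * countKind isPROP cls′ →
    (L : ℕ) → numCascadeFree cls L ≡ numCascadeFree cls′ L
corollary3p6 N cls cls′ gt≡g′t′ =
  recurrence-unique N (gens cls * props cls) refl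
    (trans (numCascadeFree-one cls) (sym (numCascadeFree-one cls′)))
    (numCascadeFree-recurrence cls) recurrence′
  where
  open CascadeFree using (gens; props; numCascadeFree-one; numCascadeFree-recurrence)
  recurrence′ : ∀ L → numCascadeFree cls′ (suc (suc L)) + gens cls * props cls * numCascadeFree cls′ L
                        ≡ N * numCascadeFree cls′ (suc L)
  recurrence′ rewrite gt≡g′t′ = numCascadeFree-recurrence cls′
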